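{- Let $m$ be a positive integer, and let $D_1,D_2$ be discriminants with $D_1\equiv D_2\bmod{(2m)^2}$. Then $\psi_{D_1}(m)=\psi_{D_2}(m)$.
   Context: A discriminant is an integer $D\equiv 0,1\bmod 4$. Write $D=d\ell^2$ with $d$ a fundamental discriminant (with $d=1$ when $D$ is a nonzero square) and $\ell\in\mathbb{Z}_{\ge0}$, and define $\psi_D(m)=\left(\frac{d}{m/\gcd(m,\ell)}\right)$ (Kronecker symbol), with the convention $\psi_0(m)=1$. -}

module Defs where

open import Data.Bool using (Bool; true; false; if_then_else_)
open import Data.Nat as ℕ using (ℕ; zero; suc; _^_)
import Data.Nat.Divisibility as ℕD
open import Data.Nat.DivMod using (_/_; _%_)
open import Data.Nat.GCD using (gcd)
open import Data.Nat.Primality using (prime?)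
open import Data.Integer as ℤ using (ℤ; +_; -[1+_]; ∣_∣)
open import Data.Integer.DivMod using (_%ℕ_)
open import Data.Integer.Divisibility as ℤD using ()
open import Data.List using (List; []; _∷_; filter; length; foldr; upTo; map)
open import Data.Bool.ListAction using (any)
open import Data.Product using (Σ; ∃; _×_; _,_)
open import Data.Sum using (_⊎_)
open import Relation.Binary.PropositionalEquality using (_≡_)
open import Relation.Nullary.Decidable using (⌊_⌋)

IsDiscriminant : ℤ → Set
IsDiscriminant D = (D %ℕ 4 ≡ 0) ⊎ (D %ℕ 4 ≡ 1)

-- squarefree natural number (0 is not squarefree since 0*0 ∣ 0)
SquareFree : ℕ → Set
SquareFree n = ∀ k → (k ℕ.* k) ℕD.∣ n → k ≡ 1

IsFundamental : ℤ → Set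
IsFundamental d =
  ((d %ℕ 4 ≡ 1) × SquareFree ∣ d ∣)
  ⊎ (Σ ℤ λ k → (d ≡ + 4 ℤ.* k) × ((k %ℕ 4 ≡ 2) ⊎ (k %ℕ 4 ≡ 3)) × SquareFree ∣ k ∣)

kronPrime : ℤ → ℕ → ℤ
kronPrime d 2 with d %ℕ 8
... | 1 = + 1
... | 7 = + 1
... | 3 = -[1+ 0 ]
... | 5 = -[1+ 0 ]
... | _ = + 0
kronPrime d p@(suc (suc _)) =
  if ⌊ p ℕD.∣? ∣ d ∣ ⌋ then + 0
  else (if any (λ x → ⌊ (x ℕ.* x) % p ℕ.≟ d %ℕ p ⌋) (upTo p)
        then + 1 else -[1+ 0 ])
kronPrime d _ = + 0   -- not used (p = 0, 1 are not prime)

-- p-adic valuation of n ≥ 1 for p ≥ 2: number of e ∈ {1..n} with p^e ∣ n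
val : ℕ → ℕ → ℕ
val p n = length (filter (λ e → p ^ e ℕD.∣? n) (map suc (upTo n)))

kronecker : ℤ → ℕ → ℤ
kronecker d n =
  foldr ℤ._*_ (+ 1)
    (map (λ p → (kronPrime d p) ℤ.^ (val p n))
         (filter prime? (upTo (suc n))))

-- natural-number quotient (total; only used with nonzero divisor)
quot : ℕ → ℕ → ℕ
quot a zero = 0
quot a (suc b) = a / suc b

-- "ψ_D(m) = v": either D = 0 and v = 1, or D = d ℓ² with d a fundamental
-- discriminant, ℓ ≥ 0, and v = (d / (m / gcd(m, ℓ))).
-- (The decomposition D = d ℓ² is unique for D ≠ 0; for D a nonzero
-- square it forces d = 1.)
PsiVal : ℤ → ℕ → ℤ → Set
PsiVal D m v =
  ((D ≡ + 0) × (v ≡ + 1))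
  ⊎ (Σ ℤ λ d → Σ ℕ λ ℓ →
       IsFundamental d × (D ≡ d ℤ.* + (ℓ ℕ.* ℓ))
       × (v ≡ kronecker d (quot m (gcd m ℓ))))

-- Both sides factor over the primes p ∣ m as ψ_D(m) = ∏ (d/p)^(a − c) with a = v_p(m) and
-- c = min(v_p(ℓ), a) = v_p(gcd(m, ℓ)), so it suffices to compare one prime at a time.
-- Write ℓᵢ = p^cᵢ uᵢ with c₁ ≤ c₂. If c₁ = a both factors are 1. Otherwise p ∤ u₁, and cancelling
-- p^(2c₁) from (2p^a)² ∣ d₁ℓ₁² − d₂ℓ₂² leaves d₁u₁² ≡ d₂(p^(c₂−c₁)u₂)² mod (2p)². If c₂ > c₁ the
-- right side is p² times a discriminant, which a fundamental d₁ cannot match: for odd p because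
-- p² ∤ d₁, for p = 2 by comparing residues mod 16. Hence c₁ = c₂, and d₁u₁² ≡ d₂u₂² with p ∤ u₁u₂,
-- modulo p (resp. 8 for p = 2), forces (d₁/p) = (d₂/p): the symbol only depends on whether p ∣ d
-- and whether d is a square mod p (resp. on d mod 8).
module Submission where

module Congruence where

  open import Data.Nat.Base as ℕ using (ℕ; zero; suc; NonZero)
  import Data.Nat.Divisibility as ℕ
  import Data.Nat.Properties as ℕ
  open import Data.Integer.Base using (ℤ; +_; _+_; _-_; _*_; -_; ∣_∣; _%ℕ_; _/ℕ_)
  open import Data.Integer.Properties
    using (+-identityʳ; +-inverseʳ; pos-*; +-injective; m-n≡m⊖n; ∣m⊝n∣≤m⊔n; ∣i∣≡0⇒i≡0;
           i-j≡0⇒i≡j)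
  open import Data.Integer.DivMod using (a≡a%ℕn+[a/ℕn]*n; n%ℕd<d)
  open import Data.Integer.Divisibility.Signed
    using (_∣_; divides; ∣-trans; ∣ᵤ⇒∣; ∣⇒∣ᵤ; ∣m⇒∣-m; ∣m∣n⇒∣m+n; ∣n⇒∣m*n; ∣m⇒∣m*n;
           *-cancelˡ-∣)
  open import Data.Integer.Tactic.RingSolver using (solve-∀)
  open import Level using (0ℓ)
  open import Relation.Binary.Bundles using (Setoid)
  open import Relation.Binary.PropositionalEquality
    using (_≡_; refl; sym; trans; cong; subst; subst₂; module ≡-Reasoning)
  open import Relation.Nullary using (contradiction)

  infix 4 _≡_mod_

  -- A record rather than a definition, so that a, b and n can be inferred.
  record _≡_mod_ (a b : ℤ) (n : ℕ) : Set where
    constructor ≡-mod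
    field n∣a-b : + n ∣ a - b

  private
    variable
      a b c e : ℤ
      k n : ℕ

  mod-refl : a ≡ a mod n
  mod-refl {a} = ≡-mod (divides (+ 0) (+-inverseʳ a))

  mod-reflexive : a ≡ b → a ≡ b mod n
  mod-reflexive refl = mod-refl

  mod-sym : a ≡ b mod n → b ≡ a mod n
  mod-sym {a} {b} (≡-mod n∣a-b) = ≡-mod (subst (_ ∣_) (negate-difference a b) (∣m⇒∣-m n∣a-b))
    where
    negate-difference : ∀ a b → - (a - b) ≡ b - a
    negate-difference = solve-∀

  mod-trans : a ≡ b mod n → b ≡ c mod n → a ≡ c mod n
  mod-trans {a = a} {b = b} {c = c} (≡-mod n∣a-b) (≡-mod n∣b-c) =
    ≡-mod (subst (_ ∣_) (telescope a b c) (∣m∣n⇒∣m+n n∣a-b n∣b-c))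
    where
    telescope : ∀ a b c → (a - b) + (b - c) ≡ a - c
    telescope = solve-∀

  mod-setoid : ℕ → Setoid 0ℓ 0ℓ
  mod-setoid n = record
    { Carrier = ℤ
    ; _≈_ = λ a b → a ≡ b mod n
    ; isEquivalence = record { refl = mod-refl ; sym = mod-sym ; trans = mod-trans }
    }

  module mod-Reasoning (n : ℕ) where
    open import Relation.Binary.Reasoning.Setoid (mod-setoid n) public

  mod-*-cong : a ≡ b mod n → c ≡ e mod n → a * c ≡ b * e mod n
  mod-*-cong {a = a} {b = b} {c = c} {e = e} (≡-mod n∣a-b) (≡-mod n∣c-e) =
    ≡-mod (subst (_ ∣_) (split a b c e) (∣m∣n⇒∣m+n (∣n⇒∣m*n a n∣c-e) (∣m⇒∣m*n e n∣a-b)))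
    where
    split : ∀ a b c e → a * (c - e) + (a - b) * e ≡ a * c - b * e
    split = solve-∀

  mod-*-congˡ : ∀ a → b ≡ c mod n → a * b ≡ a * c mod n
  mod-*-congˡ a = mod-*-cong (mod-refl {a})

  mod-*-congʳ : ∀ a → b ≡ c mod n → b * a ≡ c * a mod n
  mod-*-congʳ a b≡c = mod-*-cong b≡c (mod-refl {a})

  mod-weaken : k ℕ.∣ n → a ≡ b mod n → a ≡ b mod k
  mod-weaken k∣n (≡-mod n∣a-b) = ≡-mod (∣-trans (∣ᵤ⇒∣ k∣n) n∣a-b)

  ∣⇒mod-0 : + n ∣ a → a ≡ + 0 mod n
  ∣⇒mod-0 {a = a} n∣a = ≡-mod (subst (_ ∣_) (sym (+-identityʳ a)) n∣a)

  mod-0⇒∣ : a ≡ + 0 mod n → + n ∣ a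
  mod-0⇒∣ {a = a} (≡-mod n∣a-0) = subst (_ ∣_) (+-identityʳ a) n∣a-0

  mod-%ℕ : ∀ a n .{{_ : NonZero n}} → a ≡ + (a %ℕ n) mod n
  mod-%ℕ a n = ≡-mod (divides (a /ℕ n) (begin
    a - r                   ≡⟨ cong (_- r) (a≡a%ℕn+[a/ℕn]*n a n) ⟩
    (r + a /ℕ n * + n) - r  ≡⟨ cancel r (a /ℕ n * + n) ⟩
    a /ℕ n * + n            ∎))
    where
    open ≡-Reasoning
    r = + (a %ℕ n)
    cancel : ∀ r x → (r + x) - r ≡ x
    cancel = solve-∀

  residue-unique : ∀ {r s} → r ℕ.< n → s ℕ.< n → + r ≡ + s mod n → r ≡ s
  residue-unique {n} {r} {s} r<n s<n (≡-mod n∣r-s) =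
    +-injective (i-j≡0⇒i≡j (+ r) (+ s) (∣i∣≡0⇒i≡0 (small-multiple (∣⇒∣ᵤ n∣r-s) distance<n)))
    where
    distance<n : ∣ + r - + s ∣ ℕ.< n
    distance<n = subst (ℕ._< n) (cong ∣_∣ (sym (m-n≡m⊖n r s)))
      (ℕ.≤-<-trans (∣m⊝n∣≤m⊔n r s) (ℕ.⊔-pres-<m r<n s<n))
    small-multiple : ∀ {x} → n ℕ.∣ x → x ℕ.< n → x ≡ 0
    small-multiple {zero}  _   _   = refl
    small-multiple {suc x} n∣x x<n = contradiction n∣x (ℕ.>⇒∤ x<n)

  %ℕ≡⇒mod : .{{_ : NonZero n}} → a %ℕ n ≡ b %ℕ n → a ≡ b mod n
  %ℕ≡⇒mod {n} {a} {b} a%n≡b%n =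
    mod-trans (mod-%ℕ a n) (mod-trans (mod-reflexive (cong +_ a%n≡b%n)) (mod-sym (mod-%ℕ b n)))

  mod⇒%ℕ≡ : .{{_ : NonZero n}} → a ≡ b mod n → a %ℕ n ≡ b %ℕ n
  mod⇒%ℕ≡ {n} {a} {b} a≡b = residue-unique (n%ℕd<d a n) (n%ℕd<d b n)
    (mod-trans (mod-sym (mod-%ℕ a n)) (mod-trans a≡b (mod-%ℕ b n)))

  mod-*-cancelˡ : ∀ k .{{_ : NonZero k}} → + k * a ≡ + k * b mod (k ℕ.* n) → a ≡ b mod n
  mod-*-cancelˡ {a} {b} {n} k (≡-mod kn∣ka-kb) =
    ≡-mod (*-cancelˡ-∣ (+ k) (subst₂ _∣_ (pos-* k n) (factor (+ k) a b) kn∣ka-kb))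
    where
    factor : ∀ k a b → k * a - k * b ≡ k * (a - b)
    factor = solve-∀


module Primes where

  open import Data.Nat.Base
  open import Data.Nat.Coprimality using (Coprime)
  open import Data.Nat.Divisibility
  open import Data.Nat.Primality
    using (Prime; euclidsLemma; prime⇒irreducible; prime⇒nonZero; prime⇒nonTrivial; prime[2])
  open import Data.Nat.Properties using (*-assoc)
  open import Data.Product using (_,_)
  open import Data.Sum using (inj₁; inj₂; reduce)
  open import Function using (_∘_)
  open import Relation.Binary.PropositionalEquality using (_≡_; _≢_; refl; sym; subst)
  open import Relation.Nullary using (¬_; contradiction)

  private
    variable
      m n p u : ℕ

  prime⇒>1 : Prime p → 1 < p
  prime⇒>1 {p} pr = nonTrivial⇒n>1 p {{prime⇒nonTrivial pr}}

  prime≢1 : Prime p → p ≢ 1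
  prime≢1 pr = nonTrivial⇒≢1 {{prime⇒nonTrivial pr}}

  prime∣2⇒≡2 : Prime p → p ∣ 2 → p ≡ 2
  prime∣2⇒≡2 pr p∣2 with prime⇒irreducible prime[2] p∣2
  ... | inj₁ p≡1 = contradiction p≡1 (prime≢1 pr)
  ... | inj₂ p≡2 = p≡2

  prime²-∣-cancel : Prime p → ¬ p ∣ m → p * p ∣ m * n → p * p ∣ n
  prime²-∣-cancel {p} {m} {n} pr p∤m p²∣mn with euclidsLemma m n pr (∣-trans (m∣m*n p) p²∣mn)
  ... | inj₁ p∣m = contradiction p∣m p∤m
  ... | inj₂ (divides q refl) with euclidsLemma m q pr (*-cancelʳ-∣ p {{prime⇒nonZero pr}}
                                    (subst (p * p ∣_) (sym (*-assoc m q p)) p²∣mn))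
  ...   | inj₁ p∣m = contradiction p∣m p∤m
  ...   | inj₂ p∣q = *-monoˡ-∣ p p∣q

  prime∤-square : Prime p → ¬ p ∣ u → ¬ p ∣ u * u
  prime∤-square pr p∤u p∣u² = p∤u (reduce (euclidsLemma _ _ pr p∣u²))

  odd-prime∤4 : Prime p → p ≢ 2 → ¬ p ∣ 4
  odd-prime∤4 pr p≢2 = prime∤-square pr (p≢2 ∘ prime∣2⇒≡2 pr)

  prime∤⇒coprime : Prime p → ¬ p ∣ u → Coprime p u
  prime∤⇒coprime pr p∤u (d∣p , d∣u) with prime⇒irreducible pr d∣p
  ... | inj₁ d≡1 = d≡1
  ... | inj₂ refl = contradiction d∣u p∤u


module Discriminants where

  open import Data.Empty using (⊥)
  open import Data.Nat.Base as ℕ using (ℕ; _%_)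
  import Data.Nat.Divisibility as ℕ
  import Data.Nat.DivMod as ℕ
  import Data.Nat.Properties as ℕ
  open import Data.Nat.Primality using (Prime)
  open import Data.Integer.Base using (ℤ; +_; _*_; ∣_∣; _%ℕ_)
  open import Data.Integer.Properties using (pos-*; abs-*; *-assoc; *-identityʳ)
  open import Data.Integer.Divisibility.Signed using (_∣_; divides; ∣-refl; ∣m⇒∣m*n; ∣n⇒∣m*n; ∣⇒∣ᵤ)
  open import Data.Integer.Tactic.RingSolver using (solve-∀)
  open import Data.Nat.Tactic.RingSolver using () renaming (solve-∀ to ℕ-solve-∀)
  open import Data.Product using (_,_)
  open import Data.Sum using (_⊎_; inj₁; inj₂)
  open import Function using (_∘_)
  open import Relation.Binary.PropositionalEquality
    using (_≡_; _≢_; refl; sym; trans; cong; subst; module ≡-Reasoning)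
  open import Relation.Nullary using (¬_; yes; no)
  open import Relation.Nullary.Decidable using (toWitness; ¬?; _→-dec_; _⊎-dec_)
  open import Defs using (IsDiscriminant; IsFundamental)
  open Congruence
  open Primes

  private
    variable
      a b d e z : ℤ
      p u v : ℕ

  odd-square≡1-mod-8 : ¬ 2 ℕ.∣ u → + (u ℕ.* u) ≡ + 1 mod 8
  odd-square≡1-mod-8 {u} 2∤u = %ℕ≡⇒mod {a = + (u ℕ.* u)} {b = + 1}
    (trans (ℕ.%-distribˡ-* u u 8) (odd-residues (ℕ.m%n<n u 8) (2∤u ∘ ℕ.∣n∣m%n⇒∣m (ℕ.divides 4 refl))))
    where
    odd-residues : ∀ {r} → r ℕ.< 8 → ¬ 2 ℕ.∣ r → (r ℕ.* r) % 8 ≡ 1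
    odd-residues = toWitness {a? = ℕ.allUpTo? (λ r → ¬? (2 ℕ.∣? r) →-dec (r ℕ.* r) % 8 ℕ.≟ 1) 8} _

  discriminant-resp : a ≡ b mod 4 → IsDiscriminant b → IsDiscriminant a
  discriminant-resp a≡b = subst (λ r → r ≡ 0 ⊎ r ≡ 1) (sym (mod⇒%ℕ≡ a≡b))

  square-discriminant : ∀ n → IsDiscriminant (+ (n ℕ.* n))
  square-discriminant n = subst (λ r → r ≡ 0 ⊎ r ≡ 1) (sym (ℕ.%-distribˡ-* n n 4)) (residues (ℕ.m%n<n n 4))
    where
    residues : ∀ {r} → r ℕ.< 4 → (r ℕ.* r) % 4 ≡ 0 ⊎ (r ℕ.* r) % 4 ≡ 1
    residues = toWitness {a? = ℕ.allUpTo? (λ r → ((r ℕ.* r) % 4 ℕ.≟ 0) ⊎-dec ((r ℕ.* r) % 4 ℕ.≟ 1)) 4} _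

  discriminant-* : IsDiscriminant a → IsDiscriminant b → IsDiscriminant (a * b)
  discriminant-* {a} {b} a-disc b-disc =
    discriminant-resp (mod-*-cong (mod-%ℕ a 4) (mod-%ℕ b 4)) (residues a-disc b-disc)
    where
    residues : ∀ {r s} → r ≡ 0 ⊎ r ≡ 1 → s ≡ 0 ⊎ s ≡ 1 → IsDiscriminant (+ r * + s)
    residues (inj₁ refl) _           = inj₁ refl
    residues (inj₂ refl) (inj₁ refl) = inj₁ refl
    residues (inj₂ refl) (inj₂ refl) = inj₂ refl

  fundamental⇒discriminant : IsFundamental d → IsDiscriminant d
  fundamental⇒discriminant (inj₁ (d%4≡1 , _))  = inj₂ d%4≡1
  fundamental⇒discriminant (inj₂ (k , refl , _)) = inj₁ (mod⇒%ℕ≡ (∣⇒mod-0 (∣m⇒∣m*n k ∣-refl)))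

  fundamental⇒odd-prime²∤ : Prime p → p ≢ 2 → IsFundamental d → ¬ p ℕ.* p ℕ.∣ ∣ d ∣
  fundamental⇒odd-prime²∤ pr p≢2 (inj₁ (_ , square-free)) p²∣d = prime≢1 pr (square-free _ p²∣d)
  fundamental⇒odd-prime²∤ pr p≢2 (inj₂ (k , refl , _ , square-free)) p²∣4k =
    prime≢1 pr (square-free _ (prime²-∣-cancel pr (odd-prime∤4 pr p≢2) (subst (_ ℕ.∣_) (abs-* (+ 4) k) p²∣4k)))

  fundamental≢4*discriminant : IsFundamental d → IsDiscriminant z → ¬ 2 ℕ.∣ u →
                               ¬ (d * + (u ℕ.* u) ≡ + 4 * z mod 16)
  fundamental≢4*discriminant {d} {z} {u} (inj₁ (d%4≡1 , _)) _ 2∤u du²≡4z = ℕ.1+n≢0 (mod⇒%ℕ≡ 1≡0)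
    where
    open mod-Reasoning 2
    1≡0 : + 1 ≡ + 0 mod 2
    1≡0 = begin
      + 1 * + 1        ≈⟨ mod-*-cong (mod-weaken (ℕ.divides 2 refl) (mod-sym (%ℕ≡⇒mod {a = d} {b = + 1} d%4≡1)))
                                     (mod-weaken (ℕ.divides 4 refl) (mod-sym (odd-square≡1-mod-8 2∤u))) ⟩
      d * + (u ℕ.* u)  ≈⟨ mod-weaken (ℕ.divides 8 refl) du²≡4z ⟩
      + 4 * z          ≈⟨ ∣⇒mod-0 (∣m⇒∣m*n z (divides (+ 2) refl)) ⟩
      + 0              ∎
  fundamental≢4*discriminant {z = z} {u} (inj₂ (k , refl , k%4≡2∨3 , _)) z-disc 2∤u 4ku²≡4z =
    clash k%4≡2∨3 (discriminant-resp k≡z z-disc)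
    where
    open mod-Reasoning 4
    k≡z : k ≡ z mod 4
    k≡z = begin
      k                ≡⟨ sym (*-identityʳ k) ⟩
      k * + 1          ≈⟨ mod-*-congˡ k (mod-weaken (ℕ.divides 2 refl) (mod-sym (odd-square≡1-mod-8 2∤u))) ⟩
      k * + (u ℕ.* u)  ≈⟨ mod-*-cancelˡ 4 (subst (_≡ + 4 * z mod 16) (*-assoc (+ 4) k _) 4ku²≡4z) ⟩
      z                ∎
    clash : ∀ {r} → r ≡ 2 ⊎ r ≡ 3 → r ≡ 0 ⊎ r ≡ 1 → ⊥
    clash (inj₁ refl) (inj₁ ())
    clash (inj₁ refl) (inj₂ ())
    clash (inj₂ refl) (inj₁ ())
    clash (inj₂ refl) (inj₂ ())

  fundamental≢p²-multiple : Prime p → IsFundamental d → IsDiscriminant e → ¬ p ℕ.∣ u → p ℕ.∣ v →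
                             ¬ (d * + (u ℕ.* u) ≡ e * + (v ℕ.* v) mod ((2 ℕ.* p) ℕ.* (2 ℕ.* p)))
  fundamental≢p²-multiple {p} {d} {e} {u} pr d-fund e-disc p∤u (ℕ.divides w refl) du²≡ev² with p ℕ.≟ 2
  ... | yes refl =
    fundamental≢4*discriminant d-fund (discriminant-* {e} {+ (w ℕ.* w)} e-disc (square-discriminant w)) p∤u
      (mod-trans du²≡ev² (mod-reflexive (begin
        e * + ((w ℕ.* 2) ℕ.* (w ℕ.* 2))  ≡⟨ cong (λ x → e * + x) (ℕ-regroup w) ⟩
        e * + (4 ℕ.* (w ℕ.* w))          ≡⟨ cong (e *_) (pos-* 4 (w ℕ.* w)) ⟩
        e * (+ 4 * + (w ℕ.* w))          ≡⟨ ℤ-regroup e (+ (w ℕ.* w)) ⟩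
        + 4 * (e * + (w ℕ.* w))          ∎)))
    where
    open ≡-Reasoning
    ℕ-regroup : ∀ w → (w ℕ.* 2) ℕ.* (w ℕ.* 2) ≡ 4 ℕ.* (w ℕ.* w)
    ℕ-regroup = ℕ-solve-∀
    ℤ-regroup : ∀ e x → e * (+ 4 * x) ≡ + 4 * (e * x)
    ℤ-regroup = solve-∀
  ... | no p≢2 = fundamental⇒odd-prime²∤ pr p≢2 d-fund
    (prime²-∣-cancel pr (prime∤-square pr p∤u) (subst (_ ℕ.∣_) (trans (abs-* d (+ (u ℕ.* u))) (ℕ.*-comm ∣ d ∣ (u ℕ.* u)))
      (∣⇒∣ᵤ (mod-0⇒∣ du²≡0))))
    where
    ℕ-regroup : ∀ w p → (w ℕ.* p) ℕ.* (w ℕ.* p) ≡ (w ℕ.* w) ℕ.* (p ℕ.* p)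
    ℕ-regroup = ℕ-solve-∀
    ev²≡0 : e * + ((w ℕ.* p) ℕ.* (w ℕ.* p)) ≡ + 0 mod (p ℕ.* p)
    ev²≡0 = ∣⇒mod-0 (subst (_ ∣_)
      (sym (trans (cong (λ x → e * + x) (ℕ-regroup w p))
                  (trans (cong (e *_) (pos-* (w ℕ.* w) (p ℕ.* p))) (sym (*-assoc e _ _)))))
      (∣n⇒∣m*n (e * + (w ℕ.* w)) ∣-refl))
    du²≡0 : d * + (u ℕ.* u) ≡ + 0 mod (p ℕ.* p)
    du²≡0 = mod-trans (mod-weaken (ℕ.*-pres-∣ (ℕ.n∣m*n 2 {p}) (ℕ.n∣m*n 2 {p})) du²≡ev²) ev²≡0


module KroneckerSymbol where

  open import Data.Bool.Base using (Bool; T; if_then_else_)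
  open import Data.Bool.ListAction using (any)
  open import Data.List.Base using (upTo)
  open import Data.List.Membership.Propositional using (lose)
  open import Data.List.Membership.Propositional.Properties using (∈-upTo⁺)
  open import Data.List.Relation.Unary.Any using (satisfied)
  open import Data.List.Relation.Unary.Any.Properties using (any⁺; any⁻)
  open import Data.Nat.Base as ℕ using (ℕ; suc; NonZero; _%_)
  import Data.Nat.Divisibility as ℕ
  import Data.Nat.Properties as ℕ
  open import Data.Nat.Coprimality using (coprime-Bézout)
  open import Data.Nat.GCD using (module Bézout)
  open import Data.Nat.Primality using (Prime; euclidsLemma; ¬prime[0]; ¬prime[1])
  open import Data.Integer.Base using (ℤ; +_; -[1+_]; _+_; _-_; _*_; -_; ∣_∣; _%ℕ_)
  open import Data.Integer.Properties using (pos-*; pos-+; abs-*; neg-distribˡ-*; *-comm; *-identityʳ)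
  open import Data.Integer.DivMod using (n%ℕd<d)
  open import Data.Integer.Divisibility.Signed using (divides; ∣m⇒∣m*n; ∣ᵤ⇒∣; ∣⇒∣ᵤ)
  open import Data.Integer.Tactic.RingSolver using (solve-∀)
  open import Data.Product using (∃; _,_)
  open import Data.Sum using (inj₁; inj₂)
  open import Function using (_∘_; _⇔_; mk⇔; Equivalence)
  open import Relation.Binary.PropositionalEquality
    using (_≡_; _≢_; refl; sym; trans; cong; cong₂; subst; module ≡-Reasoning)
  open import Relation.Nullary using (¬_; Dec; yes; no; contradiction)
  open import Relation.Nullary.Decidable using (⌊_⌋; isYes≗does; does-⇔; T?; toWitness; fromWitness)
  open import Defs using (kronPrime)
  open Congruence
  open Primes
  open Discriminants

  private
    variable
      d₁ d₂ : ℤ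
      p u u₁ u₂ : ℕ

  ⌊⌋-⇔ : {A B : Set} → A ⇔ B → (a? : Dec A) (b? : Dec B) → ⌊ a? ⌋ ≡ ⌊ b? ⌋
  ⌊⌋-⇔ A⇔B a? b? = trans (isYes≗does a?) (trans (does-⇔ A⇔B a? b?) (sym (isYes≗does b?)))

  IsSquareMod : ℕ → ℤ → Set
  IsSquareMod p d = ∃ λ x → x * x ≡ d mod p

  isSquareModᵇ : ∀ p .{{_ : NonZero p}} → ℤ → Bool
  isSquareModᵇ p d = any (λ x → ⌊ (x ℕ.* x) % p ℕ.≟ d %ℕ p ⌋) (upTo p)

  T-isSquareModᵇ : ∀ p .{{_ : NonZero p}} d → T (isSquareModᵇ p d) ⇔ IsSquareMod p d
  T-isSquareModᵇ p d = mk⇔ found search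
    where
    found : T (isSquareModᵇ p d) → IsSquareMod p d
    found hit with x , x²%p≡d%p ← satisfied (any⁻ _ (upTo p) hit) =
      + x , mod-trans (mod-reflexive (sym (pos-* x x))) (%ℕ≡⇒mod {a = + (x ℕ.* x)} (toWitness x²%p≡d%p))
    search : IsSquareMod p d → T (isSquareModᵇ p d)
    search (x , x²≡d) = any⁺ _ (lose (∈-upTo⁺ (n%ℕd<d x p)) (fromWitness (mod⇒%ℕ≡ w²≡d)))
      where
      w = x %ℕ p
      w²≡d : + (w ℕ.* w) ≡ d mod p
      w²≡d = mod-trans (mod-reflexive (pos-* w w))
        (mod-trans (mod-*-cong (mod-sym (mod-%ℕ x p)) (mod-sym (mod-%ℕ x p))) x²≡d)

  pos-1+*≡* : ∀ a b c e → 1 ℕ.+ a ℕ.* b ≡ c ℕ.* e → + 1 + + a * + b ≡ + c * + e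
  pos-1+*≡* a b c e eq = begin
    + 1 + + a * + b    ≡⟨ cong (_+_ (+ 1)) (pos-* a b) ⟨
    + 1 + + (a ℕ.* b)  ≡⟨ pos-+ 1 (a ℕ.* b) ⟨
    + (1 ℕ.+ a ℕ.* b)  ≡⟨ cong +_ eq ⟩
    + (c ℕ.* e)        ≡⟨ pos-* c e ⟩
    + c * + e          ∎
    where open ≡-Reasoning

  mod-inverse : Prime p → ¬ p ℕ.∣ u → ∃ λ v → + u * v ≡ + 1 mod p
  mod-inverse {p} {u} pr p∤u with coprime-Bézout (prime∤⇒coprime pr p∤u)
  ... | Bézout.+- x y 1+yu≡xp = - + y , ≡-mod (divides (- + x) (begin
    + u * - + y - + 1    ≡⟨ rearrange (+ u) (+ y) ⟩
    - (+ 1 + + y * + u)  ≡⟨ cong -_ (pos-1+*≡* y u x p 1+yu≡xp) ⟩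
    - (+ x * + p)        ≡⟨ neg-distribˡ-* (+ x) (+ p) ⟩
    - + x * + p          ∎))
    where
    open ≡-Reasoning
    rearrange : ∀ u y → u * - y - + 1 ≡ - (+ 1 + y * u)
    rearrange = solve-∀
  ... | Bézout.-+ x y 1+xp≡yu = + y , ≡-mod (divides (+ x) (begin
    + u * + y - + 1            ≡⟨ cong (_- + 1) (trans (*-comm (+ u) (+ y)) (sym (pos-1+*≡* x p y u 1+xp≡yu))) ⟩
    (+ 1 + + x * + p) - + 1    ≡⟨ cancel (+ x * + p) ⟩
    + x * + p                  ∎))
    where
    open ≡-Reasoning
    cancel : ∀ a → (+ 1 + a) - + 1 ≡ a
    cancel = solve-∀

  divisor-transfer : ∀ d₁ u₁ d₂ → Prime p → ¬ p ℕ.∣ u₂ →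
                     d₁ * + (u₁ ℕ.* u₁) ≡ d₂ * + (u₂ ℕ.* u₂) mod p →
                     p ℕ.∣ ∣ d₁ ∣ → p ℕ.∣ ∣ d₂ ∣
  divisor-transfer {p} {u₂} d₁ u₁ d₂ pr p∤u₂ d₁u₁²≡d₂u₂² p∣d₁
    with euclidsLemma ∣ d₂ ∣ (u₂ ℕ.* u₂) pr (subst (p ℕ.∣_) (abs-* d₂ _) (∣⇒∣ᵤ p∣d₂u₂²))
    where
    p∣d₂u₂² = mod-0⇒∣ (mod-trans (mod-sym d₁u₁²≡d₂u₂²)
      (∣⇒mod-0 (∣m⇒∣m*n (+ (u₁ ℕ.* u₁)) (∣ᵤ⇒∣ {k = + p} {i = d₁} p∣d₁))))
  ... | inj₁ p∣d₂  = p∣d₂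
  ... | inj₂ p∣u₂² = contradiction p∣u₂² (prime∤-square pr p∤u₂)

  square-transfer : ∀ d₁ u₁ d₂ → Prime p → ¬ p ℕ.∣ u₂ →
                    d₁ * + (u₁ ℕ.* u₁) ≡ d₂ * + (u₂ ℕ.* u₂) mod p →
                    IsSquareMod p d₁ → IsSquareMod p d₂
  square-transfer {p} {u₂} d₁ u₁ d₂ pr p∤u₂ d₁u₁²≡d₂u₂² (x , x²≡d₁)
    with v , u₂v≡1 ← mod-inverse pr p∤u₂ = x * + u₁ * v , (begin
    (x * + u₁ * v) * (x * + u₁ * v)    ≡⟨ regroup x (+ u₁) v ⟩
    (x * x) * (+ u₁ * + u₁) * (v * v)  ≈⟨ mod-*-congʳ (v * v)
                                              (mod-*-cong x²≡d₁ (mod-reflexive (sym (pos-* u₁ u₁)))) ⟩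
    d₁ * + (u₁ ℕ.* u₁) * (v * v)       ≈⟨ mod-*-congʳ (v * v) d₁u₁²≡d₂u₂² ⟩
    d₂ * + (u₂ ℕ.* u₂) * (v * v)       ≡⟨ cong (λ x → d₂ * x * (v * v)) (pos-* u₂ u₂) ⟩
    d₂ * (+ u₂ * + u₂) * (v * v)       ≡⟨ regroup′ d₂ (+ u₂) v ⟩
    d₂ * ((+ u₂ * v) * (+ u₂ * v))     ≈⟨ mod-*-congˡ d₂ (mod-*-cong u₂v≡1 u₂v≡1) ⟩
    d₂ * (+ 1 * + 1)                   ≡⟨ *-identityʳ d₂ ⟩
    d₂                                 ∎)
    where
    open mod-Reasoning p
    regroup : ∀ x u v → (x * u * v) * (x * u * v) ≡ (x * x) * (u * u) * (v * v)
    regroup = solve-∀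
    regroup′ : ∀ d u v → d * (u * u) * (v * v) ≡ d * ((u * v) * (u * v))
    regroup′ = solve-∀
  kronPrime-odd-cong : ∀ d₁ d₂ → Prime p → p ≢ 2 → ¬ p ℕ.∣ u₁ → ¬ p ℕ.∣ u₂ →
                       d₁ * + (u₁ ℕ.* u₁) ≡ d₂ * + (u₂ ℕ.* u₂) mod p → kronPrime d₁ p ≡ kronPrime d₂ p
  kronPrime-odd-cong {0} _ _ pr = contradiction pr ¬prime[0]
  kronPrime-odd-cong {1} _ _ pr = contradiction pr ¬prime[1]
  kronPrime-odd-cong {2} _ _ _ p≢2 = contradiction refl p≢2
  kronPrime-odd-cong {p@(suc (suc (suc _)))} {u₁} {u₂} d₁ d₂ pr _ p∤u₁ p∤u₂ d₁u₁²≡d₂u₂² =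
    cong₂ (λ b c → if b then + 0 else (if c then + 1 else -[1+ 0 ]))
      (⌊⌋-⇔ divisors (p ℕ.∣? ∣ d₁ ∣) (p ℕ.∣? ∣ d₂ ∣))
      (does-⇔ squares (T? (isSquareModᵇ p d₁)) (T? (isSquareModᵇ p d₂)))
    where
    open Equivalence
    d₂u₂²≡d₁u₁² = mod-sym d₁u₁²≡d₂u₂²
    divisors : p ℕ.∣ ∣ d₁ ∣ ⇔ p ℕ.∣ ∣ d₂ ∣
    divisors = mk⇔ (divisor-transfer d₁ u₁ d₂ pr p∤u₂ d₁u₁²≡d₂u₂²)
                   (divisor-transfer d₂ u₂ d₁ pr p∤u₁ d₂u₂²≡d₁u₁²)
    squares : T (isSquareModᵇ p d₁) ⇔ T (isSquareModᵇ p d₂)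
    squares = mk⇔
      (from (T-isSquareModᵇ p d₂) ∘ square-transfer d₁ u₁ d₂ pr p∤u₂ d₁u₁²≡d₂u₂²
        ∘ to (T-isSquareModᵇ p d₁))
      (from (T-isSquareModᵇ p d₁) ∘ square-transfer d₂ u₂ d₁ pr p∤u₁ d₂u₂²≡d₁u₁²
        ∘ to (T-isSquareModᵇ p d₂))

  kronPrime-2-cong : d₁ ≡ d₂ mod 8 → kronPrime d₁ 2 ≡ kronPrime d₂ 2
  kronPrime-2-cong d₁≡d₂ rewrite mod⇒%ℕ≡ d₁≡d₂ = refl


  kronPrime-cong : ∀ d₁ d₂ → Prime p → ¬ p ℕ.∣ u₁ → ¬ p ℕ.∣ u₂ →
                   d₁ * + (u₁ ℕ.* u₁) ≡ d₂ * + (u₂ ℕ.* u₂) mod ((2 ℕ.* p) ℕ.* (2 ℕ.* p)) →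
                   kronPrime d₁ p ≡ kronPrime d₂ p
  kronPrime-cong {p} {u₁} {u₂} d₁ d₂ pr p∤u₁ p∤u₂ d₁u₁²≡d₂u₂² with p ℕ.≟ 2
  ... | yes refl = kronPrime-2-cong (begin
    d₁                  ≡⟨ *-identityʳ d₁ ⟨
    d₁ * + 1            ≈⟨ mod-*-congˡ d₁ (mod-sym (odd-square≡1-mod-8 p∤u₁)) ⟩
    d₁ * + (u₁ ℕ.* u₁)  ≈⟨ mod-weaken (ℕ.divides 2 refl) d₁u₁²≡d₂u₂² ⟩
    d₂ * + (u₂ ℕ.* u₂)  ≈⟨ mod-*-congˡ d₂ (odd-square≡1-mod-8 p∤u₂) ⟩
    d₂ * + 1            ≡⟨ *-identityʳ d₂ ⟩
    d₂                  ∎)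
    where open mod-Reasoning 8
  ... | no p≢2 = kronPrime-odd-cong d₁ d₂ pr p≢2 p∤u₁ p∤u₂
    (mod-weaken (ℕ.∣-trans (ℕ.n∣m*n 2) (ℕ.m∣m*n (2 ℕ.* p))) d₁u₁²≡d₂u₂²)

module Valuation where

  open import Data.List.Base using ([]; _∷_; _++_; filter; length; map; upTo)
  open import Data.List.Properties using (upTo-∷ʳ; map-++; filter-++; length-++)
  open import Data.Nat.Base
  open import Data.Nat.Divisibility
  open import Data.Nat.DivMod using (_/_; m/n≤m; m/n*n≡m; m≥n⇒m/n>0)
  open import Data.Nat.Induction using (<-rec)
  open import Data.Nat.GCD using (gcd; gcd-greatest; gcd[m,n]∣m; gcd[m,n]∣n)
  open import Data.Nat.Primality using (Prime; euclidsLemma; prime⇒nonZero)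
  open import Data.Nat.Properties
  open import Data.Nat.Tactic.RingSolver using (solve-∀)
  open import Data.Product using (∃; _×_; _,_)
  open import Level using (0ℓ)
  open import Data.Sum using (_⊎_; inj₁; inj₂; [_,_]′)
  import Data.Sum
  open import Function using (_∘_; _⇔_; mk⇔; Equivalence)
  open import Relation.Binary.PropositionalEquality
  open import Relation.Nullary using (¬_; yes; no; contradiction)
  open import Relation.Unary using (Pred; Decidable)
  open import Defs using (val; quot)
  open Primes

  private
    variable
      a c g k m n p v w ℓ : ℕ

  record ExactPower (p v n : ℕ) : Set where
    constructor exactPower
    field
      power∣n      : p ^ v ∣ n
      next-power∤n : ¬ p ^ suc v ∣ n

  open ExactPower

  ^-split : ∀ p → m ≤ n → p ^ n ≡ p ^ m * p ^ (n ∸ m)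
  ^-split {m} {n} p m≤n = trans (cong (p ^_) (sym (m+[n∸m]≡n m≤n))) (^-distribˡ-+-* p m (n ∸ m))

  ^-monoʳ-∣ : ∀ p → m ≤ n → p ^ m ∣ p ^ n
  ^-monoʳ-∣ {m} {n} p m≤n = divides (p ^ (n ∸ m)) (trans (^-split p m≤n) (*-comm (p ^ m) (p ^ (n ∸ m))))

  m∣m^n : ∀ m → 0 < n → m ∣ m ^ n
  m∣m^n {suc n} m _ = m∣m*n (m ^ n)

  n<m^n : 1 < m → n < m ^ n
  n<m^n {m} {zero}  _   = z<s
  n<m^n {m} {suc n} 1<m = begin-strict
    suc n          ≤⟨ n<m^n 1<m ⟩
    m ^ n          ≡⟨ *-identityˡ (m ^ n) ⟨
    1 * m ^ n      <⟨ *-monoˡ-< (m ^ n) {{m^n≢0 m n {{>-nonZero (<-trans z<s 1<m)}}}} 1<m ⟩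
    m * m ^ n      ∎
    where open ≤-Reasoning

  exactPower-∣⇔≤ : ExactPower p v n → p ^ k ∣ n ⇔ k ≤ v
  exactPower-∣⇔≤ {p} {v} {n} {k} (exactPower p^v∣n p^1+v∤n) = mk⇔
    (λ p^k∣n → ≮⇒≥ (λ v<k → p^1+v∤n (∣-trans (^-monoʳ-∣ p v<k) p^k∣n)))
    (λ k≤v → ∣-trans (^-monoʳ-∣ p k≤v) p^v∣n)

  exactPower-unique : ExactPower p v n → ExactPower p w n → v ≡ w
  exactPower-unique v-exact w-exact = ≤-antisym
    (Equivalence.to (exactPower-∣⇔≤ w-exact) (power∣n v-exact))
    (Equivalence.to (exactPower-∣⇔≤ v-exact) (power∣n w-exact))

  exactPower⇒cofactor : ExactPower p v n → ∃ λ u → n ≡ p ^ v * u × ¬ p ∣ u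
  exactPower⇒cofactor {p} {v} (exactPower (divides u refl) p^1+v∤n) =
    u , *-comm u (p ^ v) , λ p∣u → p^1+v∤n (*-monoˡ-∣ (p ^ v) p∣u)

  cofactor⇒exactPower : ∀ {p u v} .{{_ : NonZero p}} → ¬ p ∣ u → ExactPower p v (p ^ v * u)
  cofactor⇒exactPower {p} {u} {v} p∤u =
    exactPower (m∣m*n u) λ p^1+v∣ →
      p∤u (*-cancelˡ-∣ (p ^ v) {{m^n≢0 p v}} (subst (_∣ p ^ v * u) (*-comm p (p ^ v)) p^1+v∣))

  exactPower-exists : 1 < p → ∀ n → .{{NonZero n}} → ∃ λ v → ExactPower p v n
  exactPower-exists {p} 1<p n =
    <-rec (λ n → .(NonZero n) → ∃ λ v → ExactPower p v n) step n (≢-nonZero (≢-nonZero⁻¹ n))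
    where
    instance
      p≢0 : NonZero p
      p≢0 = >-nonZero (<-trans z<s 1<p)
    step : ∀ n → (∀ {m} → m < n → .(NonZero m) → ∃ λ v → ExactPower p v m) →
           .(NonZero n) → ∃ λ v → ExactPower p v n
    step n rec n≢0 with p ∣? n
    ... | no p∤n = 0 , subst (ExactPower p 0) (*-identityˡ n) (cofactor⇒exactPower p∤n)
    ... | yes (divides q refl)
      with v , q-exact ← rec (m<m*n q p {{m*n≢0⇒m≢0 q {{n≢0}}}} 1<p) (m*n≢0⇒m≢0 q {{n≢0}})
      with u , refl , p∤u ← exactPower⇒cofactor q-exact =
      suc v , subst (ExactPower p (suc v)) (regroup (p ^ v) u p) (cofactor⇒exactPower p∤u)
      where
      regroup : ∀ a u p → p * a * u ≡ a * u * p
      regroup a u p = trans (*-assoc p a u) (*-comm p (a * u))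

  exactPower-* : Prime p → ExactPower p v m → ExactPower p w n → ExactPower p (v + w) (m * n)
  exactPower-* {p} {v} {m} {w} {n} pr m-exact n-exact
    with a , refl , p∤a ← exactPower⇒cofactor m-exact
    with b , refl , p∤b ← exactPower⇒cofactor n-exact =
    subst (ExactPower p (v + w)) regroup (cofactor⇒exactPower {{prime⇒nonZero pr}} p∤ab)
    where
    p∤ab : ¬ p ∣ a * b
    p∤ab p∣ab = [ p∤a , p∤b ]′ (euclidsLemma a b pr p∣ab)
    regroup : p ^ (v + w) * (a * b) ≡ p ^ v * a * (p ^ w * b)
    regroup = begin
      p ^ (v + w) * (a * b)      ≡⟨ cong (_* (a * b)) (^-distribˡ-+-* p v w) ⟩
      p ^ v * p ^ w * (a * b)    ≡⟨ interchange (p ^ v) (p ^ w) a b ⟩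
      p ^ v * a * (p ^ w * b)    ∎
      where
      open ≡-Reasoning
      interchange : ∀ x y a b → x * y * (a * b) ≡ x * a * (y * b)
      interchange = solve-∀

  count-≤ : {P : Pred ℕ 0ℓ} (P? : Decidable P) → (∀ {e} → P e ⇔ e ≤ v) →
            ∀ k → length (filter P? (map suc (upTo k))) ≡ k ⊓ v
  count-≤ P? P⇔≤ zero    = refl
  count-≤ {v} P? P⇔≤ (suc k) = begin
    length (filter P? (map suc (upTo (suc k))))
      ≡⟨ cong (length ∘ filter P? ∘ map suc) (upTo-∷ʳ k) ⟨
    length (filter P? (map suc (upTo k ++ k ∷ [])))
      ≡⟨ cong (length ∘ filter P?) (map-++ suc (upTo k) _) ⟩
    length (filter P? (map suc (upTo k) ++ suc k ∷ []))
      ≡⟨ cong length (filter-++ P? (map suc (upTo k)) _) ⟩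
    length (filter P? (map suc (upTo k)) ++ filter P? (suc k ∷ []))
      ≡⟨ length-++ (filter P? (map suc (upTo k))) ⟩
    length (filter P? (map suc (upTo k))) + length (filter P? (suc k ∷ []))
      ≡⟨ cong (_+ _) (count-≤ P? P⇔≤ k) ⟩
    k ⊓ v + length (filter P? (suc k ∷ []))
      ≡⟨ last-step ⟩
    suc k ⊓ v
      ∎
    where
    open ≡-Reasoning
    last-step : k ⊓ v + length (filter P? (suc k ∷ [])) ≡ suc k ⊓ v
    last-step with P? (suc k)
    ... | yes P[1+k] = let 1+k≤v = Equivalence.to P⇔≤ P[1+k] in begin
      k ⊓ v + 1  ≡⟨ cong (_+ 1) (m≤n⇒m⊓n≡m (<⇒≤ 1+k≤v)) ⟩
      k + 1      ≡⟨ +-comm k 1 ⟩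
      suc k      ≡⟨ m≤n⇒m⊓n≡m 1+k≤v ⟨
      suc k ⊓ v  ∎
    ... | no ¬P[1+k] = let v≤k = ≤-pred (≰⇒> (¬P[1+k] ∘ Equivalence.from P⇔≤)) in begin
      k ⊓ v + 0  ≡⟨ +-identityʳ (k ⊓ v) ⟩
      k ⊓ v      ≡⟨ m≥n⇒m⊓n≡n v≤k ⟩
      v          ≡⟨ m≥n⇒m⊓n≡n (m≤n⇒m≤1+n v≤k) ⟨
      suc k ⊓ v  ∎

  val-exact : 1 < p → .{{NonZero n}} → ExactPower p v n → val p n ≡ v
  val-exact {p} {n} {v} 1<p n-exact =
    trans (count-≤ (λ e → p ^ e ∣? n) (exactPower-∣⇔≤ n-exact) n) (m≥n⇒m⊓n≡n v≤n)
    where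
    v≤n : v ≤ n
    v≤n = <⇒≤ (<-≤-trans (n<m^n 1<p) (∣⇒≤ (power∣n n-exact)))

  -- ℓ = p ^ exponent * cofactor with exponent = min (v_p(ℓ), a): p ^ exponent is the exact power of p
  -- dividing gcd(p ^ a, ℓ), hence gcd(m, ℓ) when v_p(m) = a.
  record Split (p a ℓ : ℕ) : Set where
    constructor mkSplit
    field
      exponent cofactor : ℕ
      exponent≤a : exponent ≤ a
      ℓ≡         : ℓ ≡ p ^ exponent * cofactor
      maximal    : exponent ≡ a ⊎ ¬ p ∣ cofactor

  split : ∀ p a ℓ → Split p a ℓ
  split p zero ℓ = mkSplit 0 ℓ z≤n (sym (+-identityʳ ℓ)) (inj₁ refl)
  split p (suc a) ℓ with p ∣? ℓ
  ... | no p∤ℓ = mkSplit 0 ℓ z≤n (sym (+-identityʳ ℓ)) (inj₂ p∤ℓ)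
  ... | yes (divides q refl) =
    mkSplit (suc e) u (s≤s e≤a) (trans (cong (_* p) q≡) (regroup (p ^ e) u p)) (Data.Sum.map₁ (cong suc) e-max)
    where
    open Split (split p a q) renaming (exponent to e; cofactor to u; exponent≤a to e≤a; ℓ≡ to q≡; maximal to e-max)
    regroup : ∀ x u p → x * u * p ≡ p * x * u
    regroup = solve-∀

  gcd-exactPower : .{{NonZero p}} → ExactPower p a m → (s : Split p a ℓ) → ExactPower p (Split.exponent s) (gcd m ℓ)
  gcd-exactPower {p} {a} {m} {ℓ} (exactPower p^a∣m p^1+a∤m) s = exactPower
    (gcd-greatest (∣-trans (^-monoʳ-∣ p e≤a) p^a∣m) (subst (p ^ e ∣_) (sym ℓ≡) (m∣m*n u)))
    (λ p^1+c∣g → [ (λ { refl → p^1+a∤m (∣-trans p^1+c∣g (gcd[m,n]∣m m ℓ)) })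
                , (λ p∤u → p∤u (*-cancelˡ-∣ (p ^ e) {{m^n≢0 p e}}
                      (subst₂ _∣_ (*-comm p (p ^ e)) ℓ≡ (∣-trans p^1+c∣g (gcd[m,n]∣n m ℓ)))))
                ]′ maximal)
    where open Split s renaming (exponent to e; cofactor to u; exponent≤a to e≤a)

  exactPower-val : 1 < p → .{{NonZero n}} → ExactPower p (val p n) n
  exactPower-val {p} {n} 1<p with v , n-exact ← exactPower-exists 1<p n =
    subst (λ v → ExactPower p v n) (sym (val-exact 1<p n-exact)) n-exact

  quot≤ : ∀ m g → quot m g ≤ m
  quot≤ m zero    = z≤n
  quot≤ m (suc g) = m/n≤m m (suc g)

  val-quot : Prime p → .{{NonZero m}} → g ∣ m → ExactPower p a m → ExactPower p c g → val p (quot m g) ≡ a ∸ c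
  val-quot {m = m} {g = zero} _ 0∣m = contradiction (0∣⇒≡0 0∣m) (≢-nonZero⁻¹ m)
  val-quot {p} {m} {g@(suc _)} {a} {c} pr g∣m m-exact g-exact = begin
    val p (m / g)            ≡⟨ m+n∸n≡m (val p (m / g)) c ⟨
    val p (m / g) + c ∸ c    ≡⟨ cong (_∸ c) (exactPower-unique (subst (ExactPower p _) (m/n*n≡m g∣m)
                                  (exactPower-* pr quot-exact g-exact)) m-exact) ⟩
    a ∸ c                    ∎
    where
    open ≡-Reasoning
    quot-exact : ExactPower p (val p (m / g)) (m / g)
    quot-exact = exactPower-val (prime⇒>1 pr) {{>-nonZero (m≥n⇒m/n>0 (∣⇒≤ g∣m))}}

  val-large : n < p → val p n ≡ 0
  val-large {zero}      _   = refl
  val-large {n@(suc _)} {p} n<p =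
    val-exact (≤-<-trans (s≤s z≤n) n<p)
      (subst (ExactPower p 0) (*-identityˡ n) (cofactor⇒exactPower {{p≢0}} (>⇒∤ n<p)))
    where p≢0 = >-nonZero (<-trans z<s n<p)


module PrimeProducts where

  open import Data.Integer.Base using (ℤ; +_; _*_)
  open import Data.List.Base using ([]; _∷_; _++_; filter; foldr; map; upTo)
  open import Data.List.Membership.Propositional.Properties using (∈-filter⁻; ∈-upTo⁻)
  open import Data.List.Properties using (upTo-∷ʳ; map-++; filter-++; foldr-++; map-cong-local)
  import Data.List.Relation.Unary.All as All
  open import Data.Nat.Base using (ℕ; zero; suc; _≤_; _<_; z≤n)
  open import Data.Nat.Primality using (Prime; prime?)
  open import Data.Nat.Properties using (_≟_; ≤-pred; ≤∧≢⇒<)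
  open import Data.Product using (_,_)
  open import Relation.Binary.PropositionalEquality
  open import Relation.Nullary using (yes; no)

  private
    variable
      M N : ℕ
      f g : ℕ → ℤ

  primeProduct : ℕ → (ℕ → ℤ) → ℤ
  primeProduct N f = foldr _*_ (+ 1) (map f (filter prime? (upTo N)))

  primeProduct-cong : (∀ {p} → Prime p → p < N → f p ≡ g p) → primeProduct N f ≡ primeProduct N g
  primeProduct-cong f≡g = cong (foldr _*_ (+ 1)) (map-cong-local (All.tabulate λ p∈ →
    let p∈upTo , p-prime = ∈-filter⁻ prime? p∈ in f≡g p-prime (∈-upTo⁻ p∈upTo)))

  primeProduct-suc : f N ≡ + 1 → primeProduct (suc N) f ≡ primeProduct N f
  primeProduct-suc {f} {N} fN≡1 = begin
    foldr _*_ (+ 1) (map f (filter prime? (upTo (suc N))))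
      ≡⟨ cong (λ ns → foldr _*_ (+ 1) (map f (filter prime? ns))) (upTo-∷ʳ N) ⟨
    foldr _*_ (+ 1) (map f (filter prime? (upTo N ++ N ∷ [])))
      ≡⟨ cong (λ ns → foldr _*_ (+ 1) (map f ns)) (filter-++ prime? (upTo N) (N ∷ [])) ⟩
    foldr _*_ (+ 1) (map f (filter prime? (upTo N) ++ filter prime? (N ∷ [])))
      ≡⟨ cong (foldr _*_ (+ 1)) (map-++ f (filter prime? (upTo N)) _) ⟩
    foldr _*_ (+ 1) (map f (filter prime? (upTo N)) ++ map f (filter prime? (N ∷ [])))
      ≡⟨ foldr-++ _*_ (+ 1) (map f (filter prime? (upTo N))) _ ⟩
    foldr _*_ (foldr _*_ (+ 1) (map f (filter prime? (N ∷ [])))) (map f (filter prime? (upTo N)))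
      ≡⟨ cong (λ z → foldr _*_ z (map f (filter prime? (upTo N)))) last-factor ⟩
    foldr _*_ (+ 1) (map f (filter prime? (upTo N)))
      ∎
    where
    open ≡-Reasoning
    last-factor : foldr _*_ (+ 1) (map f (filter prime? (N ∷ []))) ≡ + 1
    last-factor with prime? N
    ... | yes _ = cong (_* + 1) fN≡1
    ... | no _  = refl

  primeProduct-extend : (∀ {p} → N ≤ p → f p ≡ + 1) → N ≤ M → primeProduct M f ≡ primeProduct N f
  primeProduct-extend {M = zero} _ z≤n = refl
  primeProduct-extend {N} {f} {suc M} trivial N≤1+M with N ≟ suc M
  ... | yes refl = refl
  ... | no N≢1+M =
    trans (primeProduct-suc {f} {M} (trivial N≤M)) (primeProduct-extend trivial N≤M)
    where N≤M = ≤-pred (≤∧≢⇒< N≤1+M N≢1+M)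


module LocalFactors where

  open import Data.Nat.Base as ℕ using (ℕ; NonZero; _^_)
  import Data.Nat.Divisibility as ℕ
  import Data.Nat.Properties as ℕ
  open import Data.Nat.GCD using (gcd; gcd[m,n]∣m)
  open import Data.Nat.Primality using (Prime; prime⇒nonZero)
  open import Data.Integer.Base using (ℤ; +_; _*_) renaming (_^_ to _^ᶻ_)
  open import Data.Integer.Properties using (pos-*)
  open import Data.Integer.Tactic.RingSolver using (solve-∀)
  open import Data.Nat.Tactic.RingSolver using () renaming (solve-∀ to ℕ-solve-∀)
  open import Data.Product using (_×_; _,_)
  open import Data.Sum using (_⊎_; inj₁; inj₂; fromInj₂)
  open import Function using (flip)
  open import Relation.Binary.PropositionalEquality
  open import Relation.Nullary using (¬_; yes; no; contradiction)
  open import Defs using (IsFundamental; kronPrime; val; quot)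
  open Congruence
  open Primes
  open Discriminants
  open KroneckerSymbol
  open Valuation

  private
    variable
      d₁ d₂ : ℤ
      m n p ℓ₁ ℓ₂ : ℕ

  mod-cancel-square : ∀ {x y} d₁ d₂ k .{{_ : NonZero k}} →
    d₁ * + ((k ℕ.* x) ℕ.* (k ℕ.* x)) ≡ d₂ * + ((k ℕ.* y) ℕ.* (k ℕ.* y))
      mod ((k ℕ.* n) ℕ.* (k ℕ.* n)) →
    d₁ * + (x ℕ.* x) ≡ d₂ * + (y ℕ.* y) mod (n ℕ.* n)
  mod-cancel-square {n} {x} {y} d₁ d₂ k eq = mod-*-cancelˡ (k ℕ.* k) {{ℕ.m*n≢0 k k}}
    (mod-weaken (ℕ.∣-reflexive (sym (square-product k n)))
      (mod-trans (mod-reflexive (sym (expand d₁ x))) (mod-trans eq (mod-reflexive (expand d₂ y)))))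
    where
    square-product : ∀ k x → (k ℕ.* x) ℕ.* (k ℕ.* x) ≡ (k ℕ.* k) ℕ.* (x ℕ.* x)
    square-product = ℕ-solve-∀
    swap : ∀ d k x → d * (k * x) ≡ k * (d * x)
    swap = solve-∀
    expand : ∀ d x → d * + ((k ℕ.* x) ℕ.* (k ℕ.* x)) ≡ + (k ℕ.* k) * (d * + (x ℕ.* x))
    expand d x = trans (cong (λ z → d * + z) (square-product k x))
                       (trans (cong (d *_) (pos-* (k ℕ.* k) (x ℕ.* x))) (swap d (+ (k ℕ.* k)) (+ (x ℕ.* x))))

  cancel-common-power : ∀ {a c ℓ₁ ℓ₂ x y} d₁ d₂ → Prime p → c ℕ.< a →
    ℓ₁ ≡ p ^ c ℕ.* x → ℓ₂ ≡ p ^ c ℕ.* y →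
    d₁ * + (ℓ₁ ℕ.* ℓ₁) ≡ d₂ * + (ℓ₂ ℕ.* ℓ₂) mod ((2 ℕ.* p ^ a) ℕ.* (2 ℕ.* p ^ a)) →
    d₁ * + (x ℕ.* x) ≡ d₂ * + (y ℕ.* y) mod ((2 ℕ.* p) ℕ.* (2 ℕ.* p))
  cancel-common-power {p} {a} {c} d₁ d₂ pr c<a refl refl eq =
    mod-weaken (ℕ.*-pres-∣ 2p∣2q 2p∣2q)
      (mod-cancel-square d₁ d₂ (p ^ c) {{ℕ.m^n≢0 p c {{prime⇒nonZero pr}}}}
        (mod-weaken (ℕ.∣-reflexive (cong (λ z → z ℕ.* z) split-modulus)) eq))
    where
    q = p ^ (a ℕ.∸ c)
    2p∣2q : 2 ℕ.* p ℕ.∣ 2 ℕ.* q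
    2p∣2q = ℕ.*-monoʳ-∣ 2 (m∣m^n p (ℕ.m<n⇒0<n∸m c<a))
    swap : ∀ k q → k ℕ.* (2 ℕ.* q) ≡ 2 ℕ.* (k ℕ.* q)
    swap = ℕ-solve-∀
    split-modulus : p ^ c ℕ.* (2 ℕ.* q) ≡ 2 ℕ.* p ^ a
    split-modulus = trans (swap (p ^ c) q) (cong (2 ℕ.*_) (sym (^-split p (ℕ.<⇒≤ c<a))))

  unit-parts-agree : ∀ {a c₁ c₂ u₁ u₂} → Prime p → IsFundamental d₁ → IsFundamental d₂ →
    c₁ ℕ.< a → c₁ ℕ.≤ c₂ → ¬ p ℕ.∣ u₁ → c₂ ≡ a ⊎ ¬ p ℕ.∣ u₂ →
    d₁ * + ((p ^ c₁ ℕ.* u₁) ℕ.* (p ^ c₁ ℕ.* u₁)) ≡ d₂ * + ((p ^ c₂ ℕ.* u₂) ℕ.* (p ^ c₂ ℕ.* u₂))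
      mod ((2 ℕ.* p ^ a) ℕ.* (2 ℕ.* p ^ a)) →
    c₁ ≡ c₂ × kronPrime d₁ p ≡ kronPrime d₂ p
  unit-parts-agree {p} {d₁} {d₂} {c₁ = c₁} {c₂} {u₂ = u₂} pr d₁-fund d₂-fund c₁<a c₁≤c₂ p∤u₁ c₂-max eq
    with ℕ.m≤n⇒m<n∨m≡n c₁≤c₂
  ... | inj₂ refl = refl , kronPrime-cong d₁ d₂ pr p∤u₁ p∤u₂ (cancel-common-power d₁ d₂ pr c₁<a refl refl eq)
    where p∤u₂ = fromInj₂ (flip contradiction (ℕ.<⇒≢ c₁<a)) c₂-max
  ... | inj₁ c₁<c₂ = contradiction (cancel-common-power d₁ d₂ pr c₁<a refl ℓ₂≡ eq)
    (fundamental≢p²-multiple {e = d₂} pr d₁-fund (fundamental⇒discriminant {d₂} d₂-fund) p∤u₁ p∣V)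
    where
    V = p ^ (c₂ ℕ.∸ c₁) ℕ.* u₂
    ℓ₂≡ : p ^ c₂ ℕ.* u₂ ≡ p ^ c₁ ℕ.* V
    ℓ₂≡ = trans (cong (ℕ._* u₂) (^-split p (ℕ.<⇒≤ c₁<c₂))) (ℕ.*-assoc (p ^ c₁) _ u₂)
    p∣V : p ℕ.∣ V
    p∣V = ℕ.∣-trans (m∣m^n p (ℕ.m<n⇒0<n∸m c₁<c₂)) (ℕ.m∣m*n u₂)

  exponents-agree-≤ : ∀ {a} → Prime p → IsFundamental d₁ → IsFundamental d₂ →
    (s₁ : Split p a ℓ₁) (s₂ : Split p a ℓ₂) →
    Split.exponent s₁ ℕ.≤ Split.exponent s₂ →
    d₁ * + (ℓ₁ ℕ.* ℓ₁) ≡ d₂ * + (ℓ₂ ℕ.* ℓ₂) mod ((2 ℕ.* p ^ a) ℕ.* (2 ℕ.* p ^ a)) →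
    kronPrime d₁ p ^ᶻ (a ℕ.∸ Split.exponent s₁) ≡ kronPrime d₂ p ^ᶻ (a ℕ.∸ Split.exponent s₂)
  exponents-agree-≤ {p} {d₁} {d₂} {a = a} pr d₁-fund d₂-fund
    (mkSplit c₁ _ c₁≤a refl c₁-max) (mkSplit c₂ _ c₂≤a refl c₂-max) c₁≤c₂ eq with c₁ ℕ.≟ a
  ... | yes refl with refl ← ℕ.≤-antisym c₂≤a c₁≤c₂ =
    trans (cong (kronPrime d₁ p ^ᶻ_) (ℕ.n∸n≡0 c₁)) (cong (kronPrime d₂ p ^ᶻ_) (sym (ℕ.n∸n≡0 c₁)))
  ... | no c₁≢a
    with refl , kronPrime≡ ← unit-parts-agree pr d₁-fund d₂-fund (ℕ.≤∧≢⇒< c₁≤a c₁≢a) c₁≤c₂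
                               (fromInj₂ (flip contradiction c₁≢a) c₁-max) c₂-max eq =
    cong (_^ᶻ (a ℕ.∸ c₁)) kronPrime≡

  exponents-agree : ∀ {a} → Prime p → IsFundamental d₁ → IsFundamental d₂ →
    (s₁ : Split p a ℓ₁) (s₂ : Split p a ℓ₂) →
    d₁ * + (ℓ₁ ℕ.* ℓ₁) ≡ d₂ * + (ℓ₂ ℕ.* ℓ₂) mod ((2 ℕ.* p ^ a) ℕ.* (2 ℕ.* p ^ a)) →
    kronPrime d₁ p ^ᶻ (a ℕ.∸ Split.exponent s₁) ≡ kronPrime d₂ p ^ᶻ (a ℕ.∸ Split.exponent s₂)
  exponents-agree pr d₁-fund d₂-fund s₁ s₂ eq with ℕ.≤-total (Split.exponent s₁) (Split.exponent s₂)
  ... | inj₁ c₁≤c₂ = exponents-agree-≤ pr d₁-fund d₂-fund s₁ s₂ c₁≤c₂ eq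
  ... | inj₂ c₂≤c₁ = sym (exponents-agree-≤ pr d₂-fund d₁-fund s₂ s₁ c₂≤c₁ (mod-sym eq))

  kronPrime^val-cong : Prime p → .{{_ : NonZero m}} → IsFundamental d₁ → IsFundamental d₂ →
    d₁ * + (ℓ₁ ℕ.* ℓ₁) ≡ d₂ * + (ℓ₂ ℕ.* ℓ₂) mod ((2 ℕ.* m) ℕ.* (2 ℕ.* m)) →
    kronPrime d₁ p ^ᶻ val p (quot m (gcd m ℓ₁)) ≡ kronPrime d₂ p ^ᶻ val p (quot m (gcd m ℓ₂))
  kronPrime^val-cong {p} {m} {d₁} {d₂} {ℓ₁} {ℓ₂} pr d₁-fund d₂-fund eq = begin
    kronPrime d₁ p ^ᶻ val p (quot m (gcd m ℓ₁))  ≡⟨ cong (kronPrime d₁ p ^ᶻ_) (val-quot-gcd s₁) ⟩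
    kronPrime d₁ p ^ᶻ (a ℕ.∸ Split.exponent s₁)  ≡⟨ exponents-agree pr d₁-fund d₂-fund s₁ s₂ (mod-weaken 2p^a∣2m eq) ⟩
    kronPrime d₂ p ^ᶻ (a ℕ.∸ Split.exponent s₂)  ≡⟨ cong (kronPrime d₂ p ^ᶻ_) (val-quot-gcd s₂) ⟨
    kronPrime d₂ p ^ᶻ val p (quot m (gcd m ℓ₂))  ∎
    where
    open ≡-Reasoning
    a = val p m
    m-exact : ExactPower p a m
    m-exact = exactPower-val (prime⇒>1 pr)
    s₁ = split p a ℓ₁
    s₂ = split p a ℓ₂
    2p^a∣2m : (2 ℕ.* p ^ a) ℕ.* (2 ℕ.* p ^ a) ℕ.∣ (2 ℕ.* m) ℕ.* (2 ℕ.* m)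
    2p^a∣2m = ℕ.*-pres-∣ 2p^a∣2m′ 2p^a∣2m′
      where 2p^a∣2m′ = ℕ.*-monoʳ-∣ 2 (ExactPower.power∣n m-exact)
    val-quot-gcd : ∀ {ℓ} (s : Split p a ℓ) → val p (quot m (gcd m ℓ)) ≡ a ℕ.∸ Split.exponent s
    val-quot-gcd {ℓ} s = val-quot pr (gcd[m,n]∣m m ℓ) m-exact (gcd-exactPower {{prime⇒nonZero pr}} m-exact s)



open import Data.Nat.Base as ℕ using (ℕ; suc; NonZero; _^_)
import Data.Nat.Divisibility as ℕ
import Data.Nat.Properties as ℕ
open import Data.Nat.DivMod using (n/n≡1)
open import Data.Nat.GCD using (gcd; gcd-identityʳ)
open import Data.Integer.Base using (ℤ; +_; _*_; _-_) renaming (_^_ to _^ᶻ_)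
import Data.Integer.Divisibility as ℤ
open import Data.Integer.Divisibility.Signed using (∣ᵤ⇒∣)
open import Data.Product using (_,_)
open import Data.Sum using (inj₁; inj₂)
open import Relation.Binary.PropositionalEquality
open import Defs
open Congruence
open Valuation
open PrimeProducts
open LocalFactors

private
  variable
    d₁ d₂ : ℤ
    m n N ℓ₁ ℓ₂ : ℕ

record FundamentalForm (D : ℤ) (m : ℕ) (v : ℤ) : Set where
  constructor fundamentalForm
  field
    d           : ℤ
    ℓ           : ℕ
    fundamental : IsFundamental d
    D≡dℓ²       : D ≡ d * + (ℓ ℕ.* ℓ)
    v≡kronecker : v ≡ kronecker d (quot m (gcd m ℓ))

-- The case D = 0 of PsiVal is the instance d = 1, ℓ = 0: then m / gcd (m , 0) = 1 and (1 / 1) = 1.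
psiVal⇒fundamentalForm : ∀ {D v} → .{{NonZero m}} → PsiVal D m v → FundamentalForm D m v
psiVal⇒fundamentalForm (inj₂ (d , ℓ , d-fund , D≡dℓ² , v≡)) = fundamentalForm d ℓ d-fund D≡dℓ² v≡
psiVal⇒fundamentalForm {m@(suc _)} (inj₁ (refl , refl)) =
  fundamentalForm (+ 1) 0 (inj₁ (refl , 1-squareFree)) refl
    (sym (cong (kronecker (+ 1)) (trans (cong (quot m) (gcd-identityʳ m)) (n/n≡1 m))))
  where
  1-squareFree : SquareFree 1
  1-squareFree k k²∣1 = ℕ.m*n≡1⇒m≡1 k k (ℕ.∣1⇒≡1 k²∣1)

kronecker-primeProduct : ∀ d → n ℕ.≤ N → kronecker d n ≡ primeProduct (suc N) (λ p → kronPrime d p ^ᶻ val p n)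
kronecker-primeProduct d n≤N =
  sym (primeProduct-extend (λ {p} n<p → cong (kronPrime d p ^ᶻ_) (val-large n<p)) (ℕ.s≤s n≤N))

kronecker-cong : .{{NonZero m}} → IsFundamental d₁ → IsFundamental d₂ →
  d₁ * + (ℓ₁ ℕ.* ℓ₁) ≡ d₂ * + (ℓ₂ ℕ.* ℓ₂) mod ((2 ℕ.* m) ℕ.* (2 ℕ.* m)) →
  kronecker d₁ (quot m (gcd m ℓ₁)) ≡ kronecker d₂ (quot m (gcd m ℓ₂))
kronecker-cong {m} {d₁} {d₂} {ℓ₁} {ℓ₂} d₁-fund d₂-fund eq = begin
  kronecker d₁ (quot m (gcd m ℓ₁))
    ≡⟨ kronecker-primeProduct d₁ (quot≤ m (gcd m ℓ₁)) ⟩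
  primeProduct (suc m) (λ p → kronPrime d₁ p ^ᶻ val p (quot m (gcd m ℓ₁)))
    ≡⟨ primeProduct-cong {N = suc m} (λ pr _ → kronPrime^val-cong pr d₁-fund d₂-fund eq) ⟩
  primeProduct (suc m) (λ p → kronPrime d₂ p ^ᶻ val p (quot m (gcd m ℓ₂)))
    ≡⟨ kronecker-primeProduct d₂ (quot≤ m (gcd m ℓ₂)) ⟨
  kronecker d₂ (quot m (gcd m ℓ₂))
    ∎
  where open ≡-Reasoning

fundamentalForm-cong : ∀ {D₁ D₂ v₁ v₂} → .{{NonZero m}} →
  FundamentalForm D₁ m v₁ → FundamentalForm D₂ m v₂ →
  D₁ ≡ D₂ mod ((2 ℕ.* m) ℕ.* (2 ℕ.* m)) → v₁ ≡ v₂
fundamentalForm-cong {m} (fundamentalForm d₁ ℓ₁ d₁-fund refl refl) (fundamentalForm d₂ ℓ₂ d₂-fund refl refl) =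
  kronecker-cong {m} {d₁} {d₂} {ℓ₁} {ℓ₂} d₁-fund d₂-fund

lemma4p1 : (m : ℕ) → .{{_ : NonZero m}} → (D₁ D₂ : ℤ)
    → IsDiscriminant D₁ → IsDiscriminant D₂
    → (+ ((2 ℕ.* m) ^ 2)) ℤ.∣ (D₁ - D₂)
    → (v₁ v₂ : ℤ) → PsiVal D₁ m v₁ → PsiVal D₂ m v₂
    → v₁ ≡ v₂
lemma4p1 m D₁ D₂ _ _ [2m]²∣D₁-D₂ v₁ v₂ ψ₁ ψ₂ =
  fundamentalForm-cong (psiVal⇒fundamentalForm ψ₁) (psiVal⇒fundamentalForm ψ₂) D₁≡D₂
  where
  [2m]²≡[2m]*[2m] : (2 ℕ.* m) ^ 2 ≡ (2 ℕ.* m) ℕ.* (2 ℕ.* m)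
  [2m]²≡[2m]*[2m] = cong ((2 ℕ.* m) ℕ.*_) (ℕ.*-identityʳ (2 ℕ.* m))
  D₁≡D₂ : D₁ ≡ D₂ mod ((2 ℕ.* m) ℕ.* (2 ℕ.* m))
  D₁≡D₂ = mod-weaken (ℕ.∣-reflexive (sym [2m]²≡[2m]*[2m]))
            (≡-mod (∣ᵤ⇒∣ {k = + ((2 ℕ.* m) ^ 2)} [2m]²∣D₁-D₂))
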